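{- For each $p\in\{2,3,5\}$, there is no infinite squarefree word $w$ over the alphabet $\{0,1,2\}$ such that $[w]_p = 000\cdots$.
   Context: A (finite or infinite) word is squarefree if it has no factor of the form $uu$ with $u$ a nonempty word. For an infinite word $w=w_0w_1w_2\cdots$ (each $w_i$ a letter) and a positive integer $p$, $[w]_p$ denotes the infinite word $w_0w_pw_{2p}\cdots$. -}

module Defs where

open import Data.Nat using (ℕ; zero; suc; _+_; _*_; _<_)
open import Data.Fin using (Fin)
open import Data.Product using (∃-syntax; _×_)
open import Relation.Binary.PropositionalEquality using (_≡_)
open import Relation.Nullary using (¬_)

InfWord : Set → Set
InfWord A = ℕ → A

HasSquareAt : {A : Set} → InfWord A → ℕ → ℕ → Set
HasSquareAt w i n = ∀ k → k < n → w (i + k) ≡ w (i + n + k)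

Squarefree : {A : Set} → InfWord A → Set
Squarefree w = ¬ (∃[ i ] ∃[ n ] (0 < n × HasSquareAt w i n))

decimate : {A : Set} → ℕ → InfWord A → InfWord A
decimate p w j = w (j * p)

-- A word with [w]_p = 000⋯ has the letter 0 at every multiple of p, and every
-- prefix of a squarefree word is squarefree.  The squarefree words obeying
-- that constraint form a finite tree whose longest words have length 7, 12
-- and 40 for p = 2, 3 and 5, so a search of depth 8, 13 and 41 refutes every
-- branch; Agda evaluates the search.  Prefixes are stored newest letter first,
-- so a square created by the last letter is a square at the front of the list.
module Submission where

open import Defs
open import Data.Bool using (Bool; true; false; T; _∨_; if_then_else_)
open import Data.Bool.Properties using (T-∨)
open import Data.Fin as Fin using (Fin; zero)
open import Data.List using (List; []; _∷_; [_]; _++_; length; take; drop; upTo; all; allFin)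
open import Data.List.Membership.Propositional using (_∈_)
open import Data.List.Membership.Propositional.Properties using (∈-allFin)
open import Data.List.Properties using (≡-dec; ++-cancelˡ; ∷-injectiveˡ; ∷-injectiveʳ; length-++; take++drop≡id)
open import Data.List.Relation.Unary.All as All using (All)
open import Data.List.Relation.Unary.All.Properties using (all⁺)
open import Data.List.Relation.Unary.Any using (here; any?; satisfied)
open import Data.Nat using (ℕ; zero; suc; _+_; _*_; _<_; _≡ᵇ_; s≤s; z≤n; NonZero)
open import Data.Nat.DivMod using (_%_; _/_; m≡m%n+[m/n]*n)
open import Data.Nat.Properties using (+-assoc; +-comm; suc-injective; m<1+n⇒m<n∨m≡n; ≡ᵇ⇒≡)
open import Data.Product using (∃-syntax; ∃₂; _×_; _,_)
open import Data.Sum as Sum using (_⊎_; inj₁; inj₂)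
open import Function using (_∘_; Equivalence)
open import Relation.Binary.Definitions using (DecidableEquality)
open import Relation.Binary.PropositionalEquality using (_≡_; refl; sym; trans; cong; cong₂; subst; module ≡-Reasoning)
open import Relation.Nullary using (¬_; Dec)
open import Relation.Nullary.Decidable using (⌊_⌋; toWitness)

module _ {A : Set} where

  ++-cancelʳ-length : ∀ (xs ys : List A) {zs ws} → length xs ≡ length ys →
                      xs ++ zs ≡ ys ++ ws → xs ≡ ys
  ++-cancelʳ-length []       []       _ _  = refl
  ++-cancelʳ-length (x ∷ xs) (y ∷ ys) l eq =
    cong₂ _∷_ (∷-injectiveˡ eq) (++-cancelʳ-length xs ys (suc-injective l) (∷-injectiveʳ eq))

  reversedFactor : InfWord A → ℕ → ℕ → List A
  reversedFactor w i zero    = []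
  reversedFactor w i (suc n) = w (i + n) ∷ reversedFactor w i n

  length-reversedFactor : ∀ w i n → length (reversedFactor w i n) ≡ n
  length-reversedFactor w i zero    = refl
  length-reversedFactor w i (suc n) = cong suc (length-reversedFactor w i n)

  reversedFactor-+ : ∀ w i m n →
    reversedFactor w i (m + n) ≡ reversedFactor w (i + n) m ++ reversedFactor w i n
  reversedFactor-+ w i zero    n = refl
  reversedFactor-+ w i (suc m) n = cong₂ _∷_ (cong w index) (reversedFactor-+ w i m n)
    where
    index : i + (m + n) ≡ i + n + m
    index = trans (cong (i +_) (+-comm m n)) (sym (+-assoc i n m))

  reversedFactor-injective : ∀ w i j n → reversedFactor w i n ≡ reversedFactor w j n →
                             ∀ k → k < n → w (i + k) ≡ w (j + k)
  reversedFactor-injective w i j (suc n) eq k k<1+n with m<1+n⇒m<n∨m≡n k<1+n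
  ... | inj₁ k<n  = reversedFactor-injective w i j n (∷-injectiveʳ eq) k k<n
  ... | inj₂ refl = ∷-injectiveˡ eq

  BeginsWithSquare : List A → Set
  BeginsWithSquare xs = ∃₂ λ u ys → 0 < length u × xs ≡ u ++ u ++ ys

  beginsWithSquare⇒¬squarefree : ∀ w n → BeginsWithSquare (reversedFactor w 0 n) → ¬ Squarefree w
  beginsWithSquare⇒¬squarefree w n (u , ys , 0<m , eq) squarefree =
    squarefree (a , m , 0<m , square)
    where
    m = length u
    a = length ys

    n≡m+m+a : n ≡ m + (m + a)
    n≡m+m+a = begin
      n                                  ≡⟨ length-reversedFactor w 0 n ⟨
      length (reversedFactor w 0 n)      ≡⟨ cong length eq ⟩
      length (u ++ u ++ ys)              ≡⟨ length-++ u ⟩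
      m + length (u ++ ys)               ≡⟨ cong (m +_) (length-++ u) ⟩
      m + (m + a)                        ∎
      where open ≡-Reasoning

    split : reversedFactor w (m + a) m ++ reversedFactor w a m ++ reversedFactor w 0 a ≡ u ++ u ++ ys
    split = begin
      reversedFactor w (m + a) m ++ reversedFactor w a m ++ reversedFactor w 0 a
        ≡⟨ cong (reversedFactor w (m + a) m ++_) (reversedFactor-+ w 0 m a) ⟨
      reversedFactor w (m + a) m ++ reversedFactor w 0 (m + a)
        ≡⟨ reversedFactor-+ w 0 m (m + a) ⟨
      reversedFactor w 0 (m + (m + a))
        ≡⟨ cong (reversedFactor w 0) n≡m+m+a ⟨
      reversedFactor w 0 n
        ≡⟨ eq ⟩
      u ++ u ++ ys ∎
      where open ≡-Reasoning

    first : reversedFactor w (m + a) m ≡ u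
    first = ++-cancelʳ-length _ u (length-reversedFactor w (m + a) m) split

    second : reversedFactor w a m ≡ u
    second = ++-cancelʳ-length _ u (length-reversedFactor w a m)
               (++-cancelˡ u _ _ (subst (λ v → v ++ rest ≡ u ++ u ++ ys) first split))
      where rest = reversedFactor w a m ++ reversedFactor w 0 a

    square : HasSquareAt w a m
    square k k<m = begin
      w (a + k)     ≡⟨ reversedFactor-injective w a (m + a) m (trans second (sym first)) k k<m ⟩
      w (m + a + k) ≡⟨ cong (λ i → w (i + k)) (+-comm m a) ⟩
      w (a + m + k) ∎
      where open ≡-Reasoning

module _ {A : Set} (_≟_ : DecidableEquality A) where

  repeatsAt? : ∀ xs m → Dec (take m xs ≡ take m (drop m xs))
  repeatsAt? xs m = ≡-dec _≟_ (take m xs) (take m (drop m xs))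

  beginsWithSquare? : List A → Bool
  beginsWithSquare? []           = false
  beginsWithSquare? xs@(_ ∷ _) = ⌊ any? (repeatsAt? xs ∘ suc) (upTo (length xs)) ⌋

  beginsWithSquare?-sound : ∀ xs → T (beginsWithSquare? xs) → BeginsWithSquare xs
  beginsWithSquare?-sound xs@(_ ∷ _) found
    with satisfied (toWitness {a? = any? (repeatsAt? xs ∘ suc) (upTo (length xs))} found)
  ... | m , uu = u , drop (suc m) rest , s≤s z≤n , decomposition
    where
    u    = take (suc m) xs
    rest = drop (suc m) xs

    decomposition : xs ≡ u ++ u ++ drop (suc m) rest
    decomposition = begin
      xs                                            ≡⟨ take++drop≡id (suc m) xs ⟨
      u ++ rest                                     ≡⟨ cong (u ++_) (take++drop≡id (suc m) rest) ⟨
      u ++ take (suc m) rest ++ drop (suc m) rest   ≡⟨ cong (λ v → u ++ v ++ drop (suc m) rest) uu ⟨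
      u ++ u ++ drop (suc m) rest                   ∎
      where open ≡-Reasoning

  module _ (allowed : ℕ → List A) where

    squareForcedWithin : ℕ → List A → Bool
    squareForcedWithin zero    xs = false
    squareForcedWithin (suc d) xs =
      all (λ a → beginsWithSquare? (a ∷ xs) ∨ squareForcedWithin d (a ∷ xs)) (allowed (length xs))

    squareForcedWithin-sound : ∀ w → (∀ i → w i ∈ allowed i) → Squarefree w →
                               ∀ d n → ¬ T (squareForcedWithin d (reversedFactor w 0 n))
    squareForcedWithin-sound w w∈allowed squarefree (suc d) n forced =
      Sum.[ (λ square → beginsWithSquare⇒¬squarefree w (suc n) (beginsWithSquare?-sound _ square) squarefree)
      , squareForcedWithin-sound w w∈allowed squarefree d (suc n)
      ] (Equivalence.to T-∨ (All.lookup extensions (w∈allowed n)))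
      where
      Forced : A → Set
      Forced a = T (beginsWithSquare? (a ∷ reversedFactor w 0 n) ∨ squareForcedWithin d (a ∷ reversedFactor w 0 n))

      extensions : All Forced (allowed n)
      extensions = subst (All Forced ∘ allowed) (length-reversedFactor w 0 n) (all⁺ _ _ forced)

    noSquarefreeWord : ∀ d → T (squareForcedWithin d []) →
                       ¬ (∃[ w ] (Squarefree w × ∀ i → w i ∈ allowed i))
    noSquarefreeWord d forced (w , squarefree , w∈allowed) =
      squareForcedWithin-sound w w∈allowed squarefree d 0 forced

decimationConstraint : (p : ℕ) .{{_ : NonZero p}} → ℕ → List (Fin 3)
decimationConstraint p i = if i % p ≡ᵇ 0 then [ zero ] else allFin 3

decimation≡0⇒allowed : ∀ p .{{_ : NonZero p}} (w : InfWord (Fin 3)) → (∀ j → decimate p w j ≡ zero) →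
                       ∀ i → w i ∈ decimationConstraint p i
decimation≡0⇒allowed p w decimation≡0 i with i % p ≡ᵇ 0 in i%p≡ᵇ0
... | false = ∈-allFin (w i)
... | true  = here (trans (cong w i≡[i/p]*p) (decimation≡0 (i / p)))
  where
  i≡[i/p]*p : i ≡ (i / p) * p
  i≡[i/p]*p = trans (m≡m%n+[m/n]*n i p) (cong (_+ (i / p) * p) (≡ᵇ⇒≡ (i % p) 0 (subst T (sym i%p≡ᵇ0) _)))

noSquarefreeDecimatingToZero : ∀ p .{{_ : NonZero p}} d →
  T (squareForcedWithin Fin._≟_ (decimationConstraint p) d []) →
  ¬ (∃[ w ] (Squarefree {Fin 3} w × (∀ j → decimate p w j ≡ zero)))
noSquarefreeDecimatingToZero p d forced (w , squarefree , decimation≡0) =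
  noSquarefreeWord Fin._≟_ (decimationConstraint p) d forced
    (w , squarefree , decimation≡0⇒allowed p w decimation≡0)

mainTheorem5 : (p : ℕ) → (p ≡ 2 ⊎ p ≡ 3 ⊎ p ≡ 5) →
    ¬ (∃[ w ] (Squarefree {Fin 3} w × (∀ j → decimate p w j ≡ zero)))
mainTheorem5 .2 (inj₁ refl)        = noSquarefreeDecimatingToZero 2 8 _
mainTheorem5 .3 (inj₂ (inj₁ refl)) = noSquarefreeDecimatingToZero 3 13 _
mainTheorem5 .5 (inj₂ (inj₂ refl)) = noSquarefreeDecimatingToZero 5 41 _
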